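{- Let $w \in S_n$ be a minimal element of $\mathcal{C}_n$, with first descent $d$ and last descent $d'$. Then $w(i) = i$ for all $i \in [1, d-1] \cup [d'+2, n]$.
   Context: A permutation is fully commutative iff it avoids $321$; $d$ is a descent if $w(d)>w(d+1)$. $P(w)$ is the RSK insertion tableau and $\mathrm{Row}_2(P(w))$ the set of its second-row entries. A set $L$ of integers is crowded if there exist integers $x>0$, $y$ with $|[y,y+2x]\cap L|>x+1$. $\mathcal{C}_n$ is the set of fully commutative $w\in S_n$ with $\mathrm{Row}_2(P(w))$ crowded, and minimal means minimal in $\mathcal{C}_n$ with respect to the right weak order (the transitive closure of $u<us_i$ whenever $\ell(us_i)>\ell(u)$). -}

module Defs where

open import Data.Nat as ℕ using (ℕ; zero; suc; _+_; _*_; _<_; _≤_; _<?_)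
open import Data.Integer as ℤ using (ℤ; +_)
open import Data.Fin as Fin using (Fin; toℕ)
open import Data.Fin.Permutation using (Permutation′; _⟨$⟩ʳ_; transpose)
open import Data.List using (List; []; _∷_; [_]; foldl; map; length; filter; upTo; allFin; cartesianProduct)
open import Data.List.Membership.DecPropositional ℤ._≟_ using (_∈?_)
open import Data.Maybe using (Maybe; just; nothing)
open import Data.Product using (Σ; ∃; _×_; _,_; proj₁; proj₂)
open import Relation.Nullary using (¬_; yes; no)
open import Relation.Nullary.Decidable using (_×-dec_)
open import Relation.Binary.PropositionalEquality using (_≡_)
open import Relation.Binary.Construct.Closure.Transitive using (TransClosure)

-- Permutations of [1,n] are represented by stdlib permutations of Fin n
-- (0-indexed); the paper's w(i) for i ∈ [1,n] is  val w (i-1).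
val : ∀ {n} → Permutation′ n → Fin n → ℕ
val w p = suc (toℕ (w ⟨$⟩ʳ p))

word : ∀ {n} → Permutation′ n → List ℕ
word {n} w = map (val w) (allFin n)

-- fully commutative = 321-avoiding
FullyCommutative : ∀ {n} → Permutation′ n → Set
FullyCommutative {n} w =
  ¬ (Σ (Fin n) λ i → Σ (Fin n) λ j → Σ (Fin n) λ k →
       toℕ i < toℕ j × toℕ j < toℕ k × val w i ℕ.> val w j × val w j ℕ.> val w k)

-- d ∈ [1,n-1] is a descent of w  (1-indexed): w(d) > w(d+1)
Descent : ∀ {n} → Permutation′ n → ℕ → Set
Descent {n} w d = Σ (Fin n) λ p → Σ (Fin n) λ q →
  suc (toℕ p) ≡ d × toℕ q ≡ suc (toℕ p) × val w p ℕ.> val w q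

FirstDescent : ∀ {n} → Permutation′ n → ℕ → Set
FirstDescent w d = Descent w d × (∀ e → Descent w e → d ≤ e)

LastDescent : ∀ {n} → Permutation′ n → ℕ → Set
LastDescent w d = Descent w d × (∀ e → Descent w e → e ≤ d)

insertRow : ℕ → List ℕ → List ℕ × Maybe ℕ
insertRow x [] = [ x ] , nothing
insertRow x (y ∷ ys) with x <? y
... | yes _ = x ∷ ys , just y
... | no _ = y ∷ proj₁ (insertRow x ys) , proj₂ (insertRow x ys)

rowInsert : ℕ → List (List ℕ) → List (List ℕ)
rowInsert x [] = [ [ x ] ]
rowInsert x (r ∷ rs) with insertRow x r
... | r' , nothing = r' ∷ rs
... | r' , just y = r' ∷ rowInsert y rs

-- insertion tableau P(w), as a list of rows (first row first)
P : ∀ {n} → Permutation′ n → List (List ℕ)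
P w = foldl (λ T x → rowInsert x T) [] (word w)

Row₂ : List (List ℕ) → List ℕ
Row₂ (_ ∷ r ∷ _) = r
Row₂ _ = []

countIn : List ℤ → ℤ → ℕ → ℕ
countIn L y x = length (filter (λ k → (y ℤ.+ + k) ∈? L) (upTo (suc (2 * x))))

Crowded : List ℤ → Set
Crowded L = Σ ℕ λ x → Σ ℤ λ y → 0 < x × x + 1 < countIn L y x

InC : ∀ {n} → Permutation′ n → Set
InC w = FullyCommutative w × Crowded (map +_ (Row₂ (P w)))

inversions : ∀ {n} → Permutation′ n → ℕ
inversions {n} w = length (filter (λ ij → (toℕ (proj₁ ij) <? toℕ (proj₂ ij))
                                          ×-dec (val w (proj₂ ij) <? val w (proj₁ ij)))
                                  (cartesianProduct (allFin n) (allFin n)))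

-- v = u sᵢ (i.e. v(k) = u(sᵢ(k)), swapping positions i,i+1) with ℓ(v) > ℓ(u)
WeakStep : ∀ {n} → Permutation′ n → Permutation′ n → Set
WeakStep {n} u v = Σ (Fin n) λ i → Σ (Fin n) λ j →
  toℕ j ≡ suc (toℕ i) ×
  (∀ k → v ⟨$⟩ʳ k ≡ u ⟨$⟩ʳ (transpose i j ⟨$⟩ʳ k)) ×
  inversions u < inversions v

_<R_ : ∀ {n} → Permutation′ n → Permutation′ n → Set
_<R_ = TransClosure WeakStep

MinimalInC : ∀ {n} → Permutation′ n → Set
MinimalInC {n} w = InC w × (∀ (u : Permutation′ n) → InC u → ¬ (u <R w))

-- If w is minimal in 𝒞ₙ, no descent of w can be undone by an adjacent transposition that keeps
-- P(w): the result would again be 321-avoiding, with the same crowded second row, and strictly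
-- below w in the right weak order. By Knuth's theorem P is invariant under the moves yzx ↔ yxz and
-- xzy ↔ zxy (x < y < z); row by row, inserting the two sides of such a move gives the same row and
-- bumped words that are equal or again related by such a move.
-- Let the first descent be at positions i, i + 1, so w increases up to i. If w(i + 1) < w(i - 1),
-- the letters at i - 1, i, i + 1 read yzx and swapping the descent gives yxz; hence
-- w(i - 1) < w(i + 1), and by 321-avoidance every value after i exceeds w(i + 1). So each w(k)
-- with k < i is smaller than every value to its right, which forces w(k) = k. The last descent is
-- handled symmetrically with xzy ↔ zxy.

module Submission where

open import Defs
open import Data.Nat using (ℕ; suc; _+_; _<_; _≤_; _≮_; _<?_; _≤?_; z≤n; s≤s; s≤s⁻¹)
open import Data.Nat.Properties
import Data.Integer as ℤ
open import Data.Fin using (Fin; zero; suc; toℕ; inject₁; fromℕ<)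
open import Data.Fin.Properties using (toℕ-injective; toℕ-inject₁; toℕ-fromℕ<; toℕ<n)
import Data.Fin.Properties as Fin
open import Data.Fin.Induction using (<-wellFounded; >-wellFounded)
open import Data.Fin.Permutation using (Permutation′; _⟨$⟩ʳ_; _⟨$⟩ˡ_; inverseˡ; inverseʳ; transpose; _∘ₚ_)
import Data.Fin.Permutation.Components as PC
open import Data.List
  using (List; []; _∷_; _++_; [_]; fromMaybe; concat; foldl; tabulate; map; length; filter; cartesianProduct; allFin)
open import Data.List.Properties using (foldl-++; ++-identityʳ; map-tabulate; tabulate-cong)
import Data.List.Properties as List
open import Data.List.Relation.Unary.All as All using (All; []; _∷_)
import Data.List.Relation.Unary.All.Properties as All
open import Data.List.Relation.Unary.AllPairs using (AllPairs; []; _∷_)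
open import Data.List.Relation.Unary.Unique.Propositional using (Unique)
import Data.List.Relation.Unary.Unique.Propositional.Properties as Unique
open import Data.List.Relation.Binary.Permutation.Propositional
  using (_↭_; ↭-refl; ↭-sym; ↭-trans; ↭-reflexive; prep; swap; ↭⇒↭ₛ; module PermutationReasoning)
open import Data.List.Relation.Binary.Permutation.Propositional.Properties
  using (shift; shifts; ++⁺ˡ; ++⁺ʳ; ∷↭∷ʳ; ++-comm)
import Data.List.Relation.Binary.Permutation.Setoid.Properties as ↭ₛ
open import Data.Maybe using (Maybe; just; nothing)
open import Data.Product using (Σ; ∃; ∃₂; _×_; _,_; proj₁; proj₂; map₁)
open import Data.Sum using (_⊎_; inj₁; inj₂)
open import Function using (_∘_; id)
open import Relation.Nullary using (¬_; Dec; yes; no; contradiction)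
open import Relation.Nullary.Decidable using (_×-dec_)
open import Relation.Unary using (Decidable)
open import Relation.Binary.Definitions using (tri<; tri≈; tri>)
open import Relation.Binary.PropositionalEquality
  using (_≡_; _≢_; setoid; refl; sym; trans; cong; cong₂; subst; subst₂; module ≡-Reasoning)
open import Relation.Binary.Construct.Closure.Transitive using (TransClosure)
import Induction.WellFounded as WF
open import Algebra.Properties.CommutativeMonoid.Sum +-0-commutativeMonoid using (sum; sum-cong-≗; sum-permute)

-- Schensted insertion and Knuth relations

newRow : ℕ → List ℕ → List ℕ
newRow a R = proj₁ (insertRow a R)

bump : ℕ → List ℕ → Maybe ℕ
bump a R = proj₂ (insertRow a R)

insertRow-< : ∀ {a r} rs → a < r → insertRow a (r ∷ rs) ≡ (a ∷ rs , just r)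
insertRow-< {a} {r} rs a<r with a <? r
... | yes _ = refl
... | no a≮r = contradiction a<r a≮r

insertRow-≮ : ∀ {a r} rs → a ≮ r → insertRow a (r ∷ rs) ≡ map₁ (r ∷_) (insertRow a rs)
insertRow-≮ {a} {r} rs a≮r with a <? r
... | yes a<r = contradiction a<r a≮r
... | no _ = refl

insertRow-≮-≡ : ∀ {a r rs R m} → a ≮ r → insertRow a rs ≡ (R , m) → insertRow a (r ∷ rs) ≡ (r ∷ R , m)
insertRow-≮-≡ {rs = rs} a≮r eq = trans (insertRow-≮ rs a≮r) (cong (map₁ (_ ∷_)) eq)

All-newRow : ∀ {P : ℕ → Set} {a} R → All P R → P a → All P (newRow a R)
All-newRow [] _ pa = pa ∷ []
All-newRow {a = a} (r ∷ rs) (pr ∷ prs) pa with a <? r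
... | yes _ = pa ∷ prs
... | no _ = pr ∷ All-newRow rs prs pa

All-bump : ∀ {P : ℕ → Set} {a p} R → All P R → bump a R ≡ just p → P p
All-bump {a = a} (r ∷ rs) (pr ∷ prs) eq with a <? r
All-bump (r ∷ rs) (pr ∷ prs) refl | yes _ = pr
... | no _ = All-bump rs prs eq

bump-> : ∀ {a p} R → bump a R ≡ just p → a < p
bump-> {a} (r ∷ rs) eq with a <? r
bump-> (r ∷ rs) refl | yes a<r = a<r
... | no _ = bump-> rs eq

insertRow-append : ∀ {a} L → All (a ≮_) L → insertRow a L ≡ (L ++ [ a ] , nothing)
insertRow-append [] _ = refl
insertRow-append (r ∷ rs) (a≮r ∷ a≮rs) = insertRow-≮-≡ a≮r (insertRow-append rs a≮rs)

bump-nothing : ∀ {a} L → bump a L ≡ nothing → All (a ≮_) L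
bump-nothing [] _ = []
bump-nothing {a} (r ∷ rs) eq with a <? r
bump-nothing (r ∷ rs) () | yes _
... | no a≮r = a≮r ∷ bump-nothing rs eq

insertRow-skip : ∀ {a} A C → All (a ≮_) A → insertRow a (A ++ C) ≡ map₁ (A ++_) (insertRow a C)
insertRow-skip [] C _ = refl
insertRow-skip (r ∷ A) C (a≮r ∷ a≮A) = insertRow-≮-≡ a≮r (insertRow-skip A C a≮A)

bump-split : ∀ {a p} L → bump a L ≡ just p →
  ∃₂ λ A B → L ≡ A ++ p ∷ B × newRow a L ≡ A ++ a ∷ B × All (a ≮_) A
bump-split {a} (r ∷ rs) eq with a <? r
bump-split (r ∷ rs) refl | yes _ = [] , rs , refl , refl , []
... | no a≮r with bump-split rs eq
...   | A , B , L≡ , R≡ , a≮A = r ∷ A , B , cong (r ∷_) L≡ , cong (r ∷_) R≡ , a≮r ∷ a≮A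

bump-≤ : ∀ {a e} A B → a < e → All (e ≮_) A → ∃ λ p → bump a (A ++ e ∷ B) ≡ just p × e ≮ p
bump-≤ [] B a<e _ rewrite insertRow-< B a<e = _ , refl , <-irrefl refl
bump-≤ {a} (r ∷ A) B a<e (e≮r ∷ e≮A) with a <? r
... | yes _ = r , refl , e≮r
... | no _ = bump-≤ A B a<e e≮A

AllPairs-++-∷ : ∀ A {p B} → AllPairs _<_ (A ++ p ∷ B) → All (p <_) B
AllPairs-++-∷ [] (p<B ∷ _) = p<B
AllPairs-++-∷ (_ ∷ A) (_ ∷ sorted) = AllPairs-++-∷ A sorted

module _ {y z : ℕ} (y<z : y < z) where

  private
    z≮-of-y≮ : ∀ {e} → y ≮ e → z ≮ e
    z≮-of-y≮ y≮e z<e = y≮e (<-trans y<z z<e)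

  bump-nothing-mono : ∀ rs → bump y rs ≡ nothing → bump z (newRow y rs) ≡ nothing
  bump-nothing-mono rs eq
    rewrite cong proj₁ (insertRow-append rs (bump-nothing rs eq)) =
    cong proj₂ (insertRow-append (rs ++ [ y ])
      (All.++⁺ (All.map z≮-of-y≮ (bump-nothing rs eq)) (<⇒≯ y<z ∷ [])))

  bump-mono : ∀ rs → AllPairs _<_ rs → ∀ {p q} → bump y rs ≡ just p → bump z (newRow y rs) ≡ just q → p < q
  bump-mono rs sorted {p} {q} eqy eqz with bump-split rs eqy
  ... | A , B , rs≡ , newRow≡ , y≮A rewrite newRow≡ =
    All-bump B (AllPairs-++-∷ A (subst (AllPairs _<_) rs≡ sorted))
      (begin
        bump z B              ≡⟨ cong proj₂ (insertRow-≮ B (<⇒≯ y<z)) ⟨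
        bump z (y ∷ B)        ≡⟨ cong proj₂ (insertRow-skip A (y ∷ B) (All.map z≮-of-y≮ y≮A)) ⟨
        bump z (A ++ y ∷ B)   ≡⟨ eqz ⟩
        just q                ∎)
    where open ≡-Reasoning

  bump-after-bump : ∀ rs {q} → bump z rs ≡ just q → ∃ λ p → bump y (newRow z rs) ≡ just p × p < q
  bump-after-bump rs {q} eq with bump-split rs eq
  ... | A , B , _ , newRow≡ , z≮A with bump-≤ A B y<z z≮A
  ...   | p , eqp , z≮p =
    p , subst (λ R → bump y R ≡ just p) (sym newRow≡) eqp , ≤-<-trans (≮⇒≥ z≮p) (bump-> rs eq)

insertRowWord : List ℕ → List ℕ → List ℕ × List ℕ
insertRowWord R [] = R , []
insertRowWord R (a ∷ W) =
  proj₁ (insertRowWord (newRow a R) W) , fromMaybe (bump a R) ++ proj₂ (insertRowWord (newRow a R) W)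

insertRowWord-3 : ∀ R a b c {R₁ R₂ R₃ m₁ m₂ m₃} →
  insertRow a R ≡ (R₁ , m₁) → insertRow b R₁ ≡ (R₂ , m₂) → insertRow c R₂ ≡ (R₃ , m₃) →
  insertRowWord R (a ∷ b ∷ c ∷ []) ≡ (R₃ , fromMaybe m₁ ++ fromMaybe m₂ ++ fromMaybe m₃ ++ [])
insertRowWord-3 R a b c eq₁ eq₂ eq₃ rewrite eq₁ | eq₂ | eq₃ = refl

insertRowWord-skip : ∀ {r} rs W → All (_≮ r) W → insertRowWord (r ∷ rs) W ≡ map₁ (r ∷_) (insertRowWord rs W)
insertRowWord-skip rs [] _ = refl
insertRowWord-skip {r} rs (a ∷ W) (a≮r ∷ W≮r)
  rewrite insertRow-≮ rs a≮r | insertRowWord-skip (newRow a rs) W W≮r = refl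

data ElementaryKnuth : List ℕ → List ℕ → Set where
  yzx∼yxz : ∀ {x y z} → x < y → y < z → ElementaryKnuth (y ∷ z ∷ x ∷ []) (y ∷ x ∷ z ∷ [])
  xzy∼zxy : ∀ {x y z} → x < y → y < z → ElementaryKnuth (x ∷ z ∷ y ∷ []) (z ∷ x ∷ y ∷ [])

EqualOrKnuth : List ℕ → List ℕ → Set
EqualOrKnuth B B′ = B ≡ B′ ⊎ ElementaryKnuth B B′

KnuthThroughRow : List ℕ → List ℕ → List ℕ → Set
KnuthThroughRow R W W′ =
  proj₁ (insertRowWord R W) ≡ proj₁ (insertRowWord R W′) ×
  EqualOrKnuth (proj₂ (insertRowWord R W)) (proj₂ (insertRowWord R W′))

knuthThroughRow : ∀ R W W′ {S B B′} → insertRowWord R W ≡ (S , B) → insertRowWord R W′ ≡ (S , B′) →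
  EqualOrKnuth B B′ → KnuthThroughRow R W W′
knuthThroughRow R W W′ eq eq′ B∼B′ rewrite eq | eq′ = refl , B∼B′

knuthThroughRow-skip : ∀ {r rs W W′} → All (_≮ r) W → All (_≮ r) W′ →
  KnuthThroughRow rs W W′ → KnuthThroughRow (r ∷ rs) W W′
knuthThroughRow-skip {r} {rs} {W} {W′} W≮r W′≮r (row≡ , B∼B′)
  rewrite insertRowWord-skip rs W W≮r | insertRowWord-skip rs W′ W′≮r = cong (r ∷_) row≡ , B∼B′

insertRowWord-[] : ∀ {W W′} → ElementaryKnuth W W′ → insertRowWord [] W ≡ insertRowWord [] W′
insertRowWord-[] (yzx∼yxz {x} {y} {z} x<y y<z) =
  trans (insertRowWord-3 [] y z x refl (insertRow-≮-≡ (<⇒≯ y<z) refl) (insertRow-< (z ∷ []) x<y))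
        (sym (insertRowWord-3 [] y x z refl (insertRow-< [] x<y) (insertRow-≮-≡ (<⇒≯ (<-trans x<y y<z)) refl)))
insertRowWord-[] (xzy∼zxy {x} {y} {z} x<y y<z) =
  trans (insertRowWord-3 [] x z y refl (insertRow-≮-≡ (<⇒≯ (<-trans x<y y<z)) refl)
                         (insertRow-≮-≡ (<⇒≯ x<y) (insertRow-< [] y<z)))
        (sym (insertRowWord-3 [] z x y refl (insertRow-< [] (<-trans x<y y<z)) (insertRow-≮-≡ (<⇒≯ x<y) refl)))

bumps-yzx-r<y : ∀ {r} my mz → (my ≡ nothing → mz ≡ nothing) →
  (∀ {p q} → my ≡ just p → mz ≡ just q → r < p × p < q) →
  EqualOrKnuth (fromMaybe my ++ fromMaybe mz ++ [ r ] ++ []) (fromMaybe my ++ [ r ] ++ fromMaybe mz ++ [])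
bumps-yzx-r<y nothing nothing _ _ = inj₁ refl
bumps-yzx-r<y nothing (just q) none _ with () ← none refl
bumps-yzx-r<y (just p) nothing _ _ = inj₁ refl
bumps-yzx-r<y (just p) (just q) _ r<p<q = inj₂ (yzx∼yxz (proj₁ (r<p<q refl refl)) (proj₂ (r<p<q refl refl)))

bumps-yzx-y<r : ∀ {r y} mz → y < r → (∀ {q} → mz ≡ just q → r < q) →
  EqualOrKnuth ([ r ] ++ fromMaybe mz ++ [ y ] ++ []) ([ r ] ++ [ y ] ++ fromMaybe mz ++ [])
bumps-yzx-y<r nothing _ _ = inj₁ refl
bumps-yzx-y<r (just q) y<r r< = inj₂ (yzx∼yxz y<r (r< refl))

bumps-xzy-r<z : ∀ {r} mz my → (∀ {q} → mz ≡ just q → ∃ λ p → my ≡ just p × r < p × p < q) →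
  EqualOrKnuth ([ r ] ++ fromMaybe mz ++ fromMaybe my ++ []) (fromMaybe mz ++ [ r ] ++ fromMaybe my ++ [])
bumps-xzy-r<z nothing my _ = inj₁ refl
bumps-xzy-r<z (just q) my between with between refl
... | p , refl , r<p , p<q = inj₂ (xzy∼zxy r<p p<q)

FreshFor : List ℕ → List ℕ → Set
FreshFor R W = All (λ a → All (a ≢_) R) W

knuthThroughRow-yzx : ∀ {x y z} R → x < y → y < z → AllPairs _<_ R → FreshFor R (y ∷ z ∷ x ∷ []) →
  KnuthThroughRow R (y ∷ z ∷ x ∷ []) (y ∷ x ∷ z ∷ [])
knuthThroughRow-yzx [] x<y y<z _ _ = cong proj₁ eq , inj₁ (cong proj₂ eq)
  where eq = insertRowWord-[] (yzx∼yxz x<y y<z)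
knuthThroughRow-yzx {x} {y} {z} (r ∷ rs) x<y y<z (r<rs ∷ sorted) fresh@(y∉ ∷ _ ∷ x∉ ∷ []) with <-cmp r x
... | tri< r<x _ _ =
  knuthThroughRow-skip (<⇒≯ r<y ∷ <⇒≯ (<-trans r<y y<z) ∷ <⇒≯ r<x ∷ [])
                       (<⇒≯ r<y ∷ <⇒≯ r<x ∷ <⇒≯ (<-trans r<y y<z) ∷ [])
                       (knuthThroughRow-yzx rs x<y y<z sorted (All.map All.tail fresh))
  where r<y = <-trans r<x x<y
... | tri≈ _ r≡x _ = contradiction (sym r≡x) (All.head x∉)
... | tri> _ _ x<r with <-cmp r y
...   | tri≈ _ r≡y _ = contradiction (sym r≡y) (All.head y∉)
...   | tri< r<y _ _ =
  knuthThroughRow (r ∷ rs) (y ∷ z ∷ x ∷ []) (y ∷ x ∷ z ∷ [])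
    (insertRowWord-3 (r ∷ rs) y z x (insertRow-≮ rs (<⇒≯ r<y))
       (insertRow-≮ (newRow y rs) (<⇒≯ (<-trans r<y y<z))) (insertRow-< (newRow z (newRow y rs)) x<r))
    (insertRowWord-3 (r ∷ rs) y x z (insertRow-≮ rs (<⇒≯ r<y))
       (insertRow-< (newRow y rs) x<r) (insertRow-≮ (newRow y rs) (<⇒≯ (<-trans x<y y<z))))
    (bumps-yzx-r<y (bump y rs) (bump z (newRow y rs)) (bump-nothing-mono y<z rs)
       (λ eqy eqz → All-bump rs r<rs eqy , bump-mono y<z rs sorted eqy eqz))
...   | tri> _ _ y<r =
  knuthThroughRow (r ∷ rs) (y ∷ z ∷ x ∷ []) (y ∷ x ∷ z ∷ [])
    (insertRowWord-3 (r ∷ rs) y z x (insertRow-< rs y<r) (insertRow-≮ rs (<⇒≯ y<z)) (insertRow-< (newRow z rs) x<y))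
    (insertRowWord-3 (r ∷ rs) y x z (insertRow-< rs y<r) (insertRow-< rs x<y) (insertRow-≮ rs (<⇒≯ (<-trans x<y y<z))))
    (bumps-yzx-y<r (bump z rs) y<r (All-bump rs r<rs))

-- if r has a successor s the bumped words are r s z and r z s, otherwise both are r z
knuthThroughRow-xzy-z<r : ∀ {x y z r} rs → x < y → y < z → z < r → All (r <_) rs →
  KnuthThroughRow (r ∷ rs) (x ∷ z ∷ y ∷ []) (z ∷ x ∷ y ∷ [])
knuthThroughRow-xzy-z<r {x} {y} {z} {r} [] x<y y<z z<r [] =
  knuthThroughRow (r ∷ []) (x ∷ z ∷ y ∷ []) (z ∷ x ∷ y ∷ [])
    (insertRowWord-3 (r ∷ []) x z y (insertRow-< [] x<r) (insertRow-≮-≡ (<⇒≯ x<z) refl)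
       (insertRow-≮-≡ (<⇒≯ x<y) (insertRow-< [] y<z)))
    (insertRowWord-3 (r ∷ []) z x y (insertRow-< [] z<r) (insertRow-< [] x<z) (insertRow-≮-≡ (<⇒≯ x<y) refl))
    (inj₁ refl)
  where x<z = <-trans x<y y<z
        x<r = <-trans x<z z<r
knuthThroughRow-xzy-z<r {x} {y} {z} {r} (s ∷ t) x<y y<z z<r (r<s ∷ _) =
  knuthThroughRow (r ∷ s ∷ t) (x ∷ z ∷ y ∷ []) (z ∷ x ∷ y ∷ [])
    (insertRowWord-3 (r ∷ s ∷ t) x z y (insertRow-< (s ∷ t) x<r)
       (insertRow-≮-≡ (<⇒≯ x<z) (insertRow-< t (<-trans z<r r<s)))
       (insertRow-≮-≡ (<⇒≯ x<y) (insertRow-< t y<z)))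
    (insertRowWord-3 (r ∷ s ∷ t) z x y (insertRow-< (s ∷ t) z<r) (insertRow-< (s ∷ t) x<z)
       (insertRow-≮-≡ (<⇒≯ x<y) (insertRow-< t (<-trans (<-trans y<z z<r) r<s))))
    (inj₂ (yzx∼yxz z<r r<s))
  where x<z = <-trans x<y y<z
        x<r = <-trans x<z z<r

knuthThroughRow-xzy : ∀ {x y z} R → x < y → y < z → AllPairs _<_ R → FreshFor R (x ∷ z ∷ y ∷ []) →
  KnuthThroughRow R (x ∷ z ∷ y ∷ []) (z ∷ x ∷ y ∷ [])
knuthThroughRow-xzy [] x<y y<z _ _ = cong proj₁ eq , inj₁ (cong proj₂ eq)
  where eq = insertRowWord-[] (xzy∼zxy x<y y<z)
knuthThroughRow-xzy {x} {y} {z} (r ∷ rs) x<y y<z (r<rs ∷ sorted) fresh@(x∉ ∷ z∉ ∷ _ ∷ []) with <-cmp r x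
... | tri< r<x _ _ =
  knuthThroughRow-skip (<⇒≯ r<x ∷ <⇒≯ (<-trans r<y y<z) ∷ <⇒≯ r<y ∷ [])
                       (<⇒≯ (<-trans r<y y<z) ∷ <⇒≯ r<x ∷ <⇒≯ r<y ∷ [])
                       (knuthThroughRow-xzy rs x<y y<z sorted (All.map All.tail fresh))
  where r<y = <-trans r<x x<y
... | tri≈ _ r≡x _ = contradiction (sym r≡x) (All.head x∉)
... | tri> _ _ x<r with <-cmp r z
...   | tri≈ _ r≡z _ = contradiction (sym r≡z) (All.head z∉)
...   | tri< r<z _ _ =
  knuthThroughRow (r ∷ rs) (x ∷ z ∷ y ∷ []) (z ∷ x ∷ y ∷ [])
    (insertRowWord-3 (r ∷ rs) x z y (insertRow-< rs x<r) (insertRow-≮ rs (<⇒≯ x<z))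
       (insertRow-≮ (newRow z rs) (<⇒≯ x<y)))
    (insertRowWord-3 (r ∷ rs) z x y (insertRow-≮ rs (<⇒≯ r<z)) (insertRow-< (newRow z rs) x<r)
       (insertRow-≮ (newRow z rs) (<⇒≯ x<y)))
    (bumps-xzy-r<z (bump z rs) (bump y (newRow z rs)) λ eq → case-between eq (bump-after-bump y<z rs eq))
  where
  x<z = <-trans x<y y<z
  case-between : ∀ {q} → bump z rs ≡ just q → ∃ (λ p → bump y (newRow z rs) ≡ just p × p < q) →
                 ∃ λ p → bump y (newRow z rs) ≡ just p × r < p × p < q
  case-between _ (p , eq , p<q) = p , eq , All-bump (newRow z rs) (All-newRow rs r<rs r<z) eq , p<q
...   | tri> _ _ z<r = knuthThroughRow-xzy-z<r rs x<y y<z z<r r<rs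

knuthThroughRow-elementary : ∀ R {W W′} → ElementaryKnuth W W′ → AllPairs _<_ R → FreshFor R W →
  KnuthThroughRow R W W′
knuthThroughRow-elementary R (yzx∼yxz x<y y<z) = knuthThroughRow-yzx R x<y y<z
knuthThroughRow-elementary R (xzy∼zxy x<y y<z) = knuthThroughRow-xzy R x<y y<z

-- Knuth invariance of the insertion tableau

insertWord : List (List ℕ) → List ℕ → List (List ℕ)
insertWord T W = foldl (λ T x → rowInsert x T) T W

rowInsert-∷ : ∀ a R rest → rowInsert a (R ∷ rest) ≡ newRow a R ∷ insertWord rest (fromMaybe (bump a R))
rowInsert-∷ a R rest with insertRow a R
... | _ , nothing = refl
... | _ , just _ = refl

insertWord-∷ : ∀ R rest W →
  insertWord (R ∷ rest) W ≡ proj₁ (insertRowWord R W) ∷ insertWord rest (proj₂ (insertRowWord R W))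
insertWord-∷ R rest [] = refl
insertWord-∷ R rest (a ∷ W)
  rewrite rowInsert-∷ a R rest
        | insertWord-∷ (newRow a R) (insertWord rest (fromMaybe (bump a R))) W
        | foldl-++ (λ T x → rowInsert x T) rest (fromMaybe (bump a R)) (proj₂ (insertRowWord (newRow a R) W)) = refl

insertWord-∷-cong : ∀ R rest {W W′} → proj₁ (insertRowWord R W) ≡ proj₁ (insertRowWord R W′) →
  insertWord rest (proj₂ (insertRowWord R W)) ≡ insertWord rest (proj₂ (insertRowWord R W′)) →
  insertWord (R ∷ rest) W ≡ insertWord (R ∷ rest) W′
insertWord-∷-cong R rest {W} {W′} row≡ rest≡ = begin
  insertWord (R ∷ rest) W                                                  ≡⟨ insertWord-∷ R rest W ⟩
  proj₁ (insertRowWord R W) ∷ insertWord rest (proj₂ (insertRowWord R W))      ≡⟨ cong₂ _∷_ row≡ rest≡ ⟩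
  proj₁ (insertRowWord R W′) ∷ insertWord rest (proj₂ (insertRowWord R W′))    ≡⟨ insertWord-∷ R rest W′ ⟨
  insertWord (R ∷ rest) W′                                                 ∎
  where open ≡-Reasoning

Unique-resp-↭ : ∀ {xs ys : List ℕ} → xs ↭ ys → Unique xs → Unique ys
Unique-resp-↭ p = ↭ₛ.Unique-resp-↭ (setoid ℕ) (↭⇒↭ₛ p)

Unique-++⁻ʳ : ∀ (xs : List ℕ) {ys} → Unique (xs ++ ys) → Unique ys
Unique-++⁻ʳ [] u = u
Unique-++⁻ʳ (_ ∷ xs) (_ ∷ u) = Unique-++⁻ʳ xs u

insertRow-↭ : ∀ a R → newRow a R ++ fromMaybe (bump a R) ↭ a ∷ R
insertRow-↭ a [] = ↭-refl
insertRow-↭ a (r ∷ rs) with a <? r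
... | yes _ = prep a (↭-sym (∷↭∷ʳ r rs))
... | no _ = ↭-trans (prep r (insertRow-↭ a rs)) (swap r a ↭-refl)

insertRow-++-↭ : ∀ a R X → newRow a R ++ fromMaybe (bump a R) ++ X ↭ a ∷ R ++ X
insertRow-++-↭ a R X = ↭-trans (↭-reflexive (sym (List.++-assoc (newRow a R) _ X))) (++⁺ʳ X (insertRow-↭ a R))

insertRowWord-↭ : ∀ R W → proj₁ (insertRowWord R W) ++ proj₂ (insertRowWord R W) ↭ W ++ R
insertRowWord-↭ R [] = ↭-reflexive (++-identityʳ R)
insertRowWord-↭ R (a ∷ W) = begin
  S ++ m ++ B     ↭⟨ shifts S m ⟩
  m ++ S ++ B     ↭⟨ ++⁺ˡ m (insertRowWord-↭ (newRow a R) W) ⟩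
  m ++ W ++ R₁    ↭⟨ shifts m W ⟩
  W ++ m ++ R₁    ↭⟨ ++⁺ˡ W (↭-trans (++-comm m R₁) (insertRow-↭ a R)) ⟩
  W ++ a ∷ R      ↭⟨ shift a W R ⟩
  a ∷ W ++ R      ∎
  where
  open PermutationReasoning
  R₁ = newRow a R
  m = fromMaybe (bump a R)
  S = proj₁ (insertRowWord R₁ W)
  B = proj₂ (insertRowWord R₁ W)

rowInsert-↭ : ∀ a T → concat (rowInsert a T) ↭ a ∷ concat T
rowInsert-↭ a [] = ↭-refl
rowInsert-↭ a (R ∷ rest) rewrite rowInsert-∷ a R rest =
  ↭-trans (++⁺ˡ (newRow a R) (below (bump a R))) (insertRow-++-↭ a R (concat rest))
  where
  below : ∀ m → concat (insertWord rest (fromMaybe m)) ↭ fromMaybe m ++ concat rest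
  below nothing = ↭-refl
  below (just v) = rowInsert-↭ v rest

newRow-sorted : ∀ a R → AllPairs _<_ R → All (a ≢_) R → AllPairs _<_ (newRow a R)
newRow-sorted a [] _ _ = [] ∷ []
newRow-sorted a (r ∷ rs) (r<rs ∷ sorted) (a≢r ∷ a∉rs) with a <? r
... | yes a<r = All.map (<-trans a<r) r<rs ∷ sorted
... | no a≮r = All-newRow rs r<rs (≤∧≢⇒< (≮⇒≥ a≮r) (a≢r ∘ sym)) ∷ newRow-sorted a rs sorted a∉rs

rowInsert-sorted : ∀ a T → All (AllPairs _<_) T → Unique (a ∷ concat T) → All (AllPairs _<_) (rowInsert a T)
rowInsert-sorted a [] _ _ = ([] ∷ []) ∷ []
rowInsert-sorted a (R ∷ rest) (sorted ∷ sorted-rest) unique@(a∉ ∷ _) rewrite rowInsert-∷ a R rest =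
  newRow-sorted a R sorted (All.++⁻ˡ R a∉) ∷
  below (bump a R) (Unique-++⁻ʳ (newRow a R) (Unique-resp-↭ (↭-sym (insertRow-++-↭ a R (concat rest))) unique))
  where
  below : ∀ m → Unique (fromMaybe m ++ concat rest) → All (AllPairs _<_) (insertWord rest (fromMaybe m))
  below nothing _ = sorted-rest
  below (just v) u = rowInsert-sorted v rest sorted-rest u

WellFormed : List (List ℕ) → List ℕ → Set
WellFormed T W = All (AllPairs _<_) T × Unique (W ++ concat T)

wellFormed-rowInsert : ∀ a W T → WellFormed T (a ∷ W) → WellFormed (rowInsert a T) W
wellFormed-rowInsert a W T (sorted , unique) =
  rowInsert-sorted a T sorted (Unique-++⁻ʳ W (Unique-resp-↭ (↭-sym (shift a W (concat T))) unique)) ,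
  Unique-resp-↭ (↭-sym (↭-trans (++⁺ˡ W (rowInsert-↭ a T)) (shift a W (concat T)))) unique

wellFormed-freshFor : ∀ {R rest} W → WellFormed (R ∷ rest) W → FreshFor R W
wellFormed-freshFor [] _ = []
wellFormed-freshFor {R} (a ∷ W) (sorted , a∉ ∷ unique) =
  All.++⁻ˡ R (All.++⁻ʳ W a∉) ∷ wellFormed-freshFor W (sorted , unique)

wellFormed-bumped : ∀ {R rest} W → WellFormed (R ∷ rest) W → WellFormed rest (proj₂ (insertRowWord R W))
wellFormed-bumped {R} {rest} W (_ ∷ sorted , unique) =
  sorted , Unique-++⁻ʳ (proj₁ (insertRowWord R W)) (Unique-resp-↭ (↭-sym bumped-↭) unique)
  where
  bumped-↭ : proj₁ (insertRowWord R W) ++ proj₂ (insertRowWord R W) ++ concat rest ↭ W ++ R ++ concat rest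
  bumped-↭ = ↭-trans (↭-reflexive (sym (List.++-assoc (proj₁ (insertRowWord R W)) _ (concat rest))))
             (↭-trans (++⁺ʳ (concat rest) (insertRowWord-↭ R W)) (↭-reflexive (List.++-assoc W R (concat rest))))

insertWord-elementaryKnuth : ∀ T {W W′} → ElementaryKnuth W W′ → WellFormed T W → insertWord T W ≡ insertWord T W′
insertWord-elementaryKnuth [] {W} {W′} kn@(yzx∼yxz _ _) _ =
  insertWord-∷-cong [] [] {W} {W′} (cong proj₁ (insertRowWord-[] kn)) (cong (insertWord [] ∘ proj₂) (insertRowWord-[] kn))
insertWord-elementaryKnuth [] {W} {W′} kn@(xzy∼zxy _ _) _ =
  insertWord-∷-cong [] [] {W} {W′} (cong proj₁ (insertRowWord-[] kn)) (cong (insertWord [] ∘ proj₂) (insertRowWord-[] kn))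
insertWord-elementaryKnuth (R ∷ rest) {W} {W′} kn wf@(sorted ∷ _ , _)
  with knuthThroughRow-elementary R kn sorted (wellFormed-freshFor W wf)
... | row≡ , inj₁ bumped≡ = insertWord-∷-cong R rest {W} {W′} row≡ (cong (insertWord rest) bumped≡)
... | row≡ , inj₂ kn′ =
  insertWord-∷-cong R rest {W} {W′} row≡ (insertWord-elementaryKnuth rest kn′ (wellFormed-bumped W wf))

data KnuthStep : List ℕ → List ℕ → Set where
  here  : ∀ {W W′} L → ElementaryKnuth W W′ → KnuthStep (W ++ L) (W′ ++ L)
  there : ∀ x {L L′} → KnuthStep L L′ → KnuthStep (x ∷ L) (x ∷ L′)

insertWord-knuth : ∀ {V V′} → KnuthStep V V′ → ∀ T → WellFormed T V → insertWord T V ≡ insertWord T V′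
insertWord-knuth (here {W} {W′} L kn) T (sorted , unique) = begin
  insertWord T (W ++ L)            ≡⟨ foldl-++ _ T W L ⟩
  insertWord (insertWord T W) L    ≡⟨ cong (λ T′ → insertWord T′ L) (insertWord-elementaryKnuth T kn (sorted , unique′)) ⟩
  insertWord (insertWord T W′) L   ≡⟨ foldl-++ _ T W′ L ⟨
  insertWord T (W′ ++ L)           ∎
  where
  open ≡-Reasoning
  unique′ : Unique (W ++ concat T)
  unique′ = Unique-++⁻ʳ L (Unique-resp-↭ (↭-trans (↭-reflexive (List.++-assoc W L (concat T))) (shifts W L)) unique)
insertWord-knuth (there x {L} k) T wf = insertWord-knuth k (rowInsert x T) (wellFormed-rowInsert x L T wf)

⟨$⟩ʳ-injective : ∀ {n} (w : Permutation′ n) {a b} → w ⟨$⟩ʳ a ≡ w ⟨$⟩ʳ b → a ≡ b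
⟨$⟩ʳ-injective w {a} {b} eq = begin
  a                        ≡⟨ inverseˡ w ⟨
  w ⟨$⟩ˡ (w ⟨$⟩ʳ a)        ≡⟨ cong (w ⟨$⟩ˡ_) eq ⟩
  w ⟨$⟩ˡ (w ⟨$⟩ʳ b)        ≡⟨ inverseˡ w ⟩
  b                        ∎
  where open ≡-Reasoning

val-injective : ∀ {n} (w : Permutation′ n) {a b} → val w a ≡ val w b → a ≡ b
val-injective w = ⟨$⟩ʳ-injective w ∘ toℕ-injective ∘ suc-injective

word-tabulate : ∀ {n} (w : Permutation′ n) → word w ≡ tabulate (val w)
word-tabulate w = map-tabulate id (val w)

word-unique : ∀ {n} (w : Permutation′ n) → Unique (word w)
word-unique w = subst Unique (sym (word-tabulate w)) (Unique.tabulate⁺ (val-injective w))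

knuthStep-tabulate : ∀ {n} (f g : Fin n → ℕ) (i₀ i₁ i₂ : Fin n) →
  toℕ i₁ ≡ suc (toℕ i₀) → toℕ i₂ ≡ suc (toℕ i₁) →
  (∀ k → k ≢ i₀ → k ≢ i₁ → k ≢ i₂ → f k ≡ g k) →
  ElementaryKnuth (f i₀ ∷ f i₁ ∷ f i₂ ∷ []) (g i₀ ∷ g i₁ ∷ g i₂ ∷ []) → KnuthStep (tabulate f) (tabulate g)
knuthStep-tabulate {suc (suc (suc m))} f g zero (suc zero) (suc (suc zero)) refl refl agree kn =
  subst (λ L → KnuthStep (f zero ∷ f (suc zero) ∷ f (suc (suc zero)) ∷ tabulate (λ k → f (suc (suc (suc k)))))
                         (g zero ∷ g (suc zero) ∷ g (suc (suc zero)) ∷ L))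
        (tabulate-cong (λ k → agree (suc (suc (suc k))) (λ ()) (λ ()) (λ ())))
        (here (tabulate (λ k → f (suc (suc (suc k))))) kn)
knuthStep-tabulate {suc m} f g (suc i₀) (suc i₁) (suc i₂) i₁≡ i₂≡ agree kn =
  subst (λ x → KnuthStep (f zero ∷ tabulate (λ k → f (suc k))) (x ∷ tabulate (λ k → g (suc k))))
        (agree zero (λ ()) (λ ()) (λ ()))
        (there (f zero) (knuthStep-tabulate (λ k → f (suc k)) (λ k → g (suc k)) i₀ i₁ i₂
           (suc-injective i₁≡) (suc-injective i₂≡)
           (λ k k≢i₀ k≢i₁ k≢i₂ →
              agree (suc k) (k≢i₀ ∘ Fin.suc-injective) (k≢i₁ ∘ Fin.suc-injective) (k≢i₂ ∘ Fin.suc-injective))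
           kn))
knuthStep-tabulate f g zero zero _ () _ _ _
knuthStep-tabulate f g zero (suc zero) zero _ () _ _
knuthStep-tabulate f g zero (suc zero) (suc zero) _ () _ _
knuthStep-tabulate f g zero (suc zero) (suc (suc (suc _))) _ () _ _
knuthStep-tabulate f g zero (suc (suc _)) _ () _ _ _
knuthStep-tabulate f g (suc _) zero _ () _ _ _
knuthStep-tabulate f g (suc _) (suc _) zero _ () _ _

P-knuth : ∀ {n} (u w : Permutation′ n) (i₀ i₁ i₂ : Fin n) →
  toℕ i₁ ≡ suc (toℕ i₀) → toℕ i₂ ≡ suc (toℕ i₁) →
  (∀ k → k ≢ i₀ → k ≢ i₁ → k ≢ i₂ → val u k ≡ val w k) →
  ElementaryKnuth (val u i₀ ∷ val u i₁ ∷ val u i₂ ∷ []) (val w i₀ ∷ val w i₁ ∷ val w i₂ ∷ []) → P u ≡ P w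
P-knuth u w i₀ i₁ i₂ i₁≡ i₂≡ agree kn =
  insertWord-knuth step [] ([] , subst Unique (sym (++-identityʳ _)) (word-unique u))
  where
  step : KnuthStep (word u) (word w)
  step = subst₂ KnuthStep (sym (word-tabulate u)) (sym (word-tabulate w))
           (knuthStep-tabulate (val u) (val w) i₀ i₁ i₂ i₁≡ i₂≡ agree kn)

-- Adjacent transpositions and the right weak order

≢-of-toℕ-< : ∀ {n} {a b : Fin n} → toℕ a < toℕ b → a ≢ b
≢-of-toℕ-< a<b = <⇒≢ a<b ∘ cong toℕ

transpose-left : ∀ {n} (i j : Fin n) → PC.transpose i j i ≡ j
transpose-left i j with i Fin.≟ i
... | yes _ = refl
... | no i≢i = contradiction refl i≢i

transpose-right : ∀ {n} (i j : Fin n) → PC.transpose i j j ≡ i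
transpose-right i j with j Fin.≟ i
... | yes j≡i = j≡i
... | no _ with j Fin.≟ j
...   | yes _ = refl
...   | no j≢j = contradiction refl j≢j

transpose-other : ∀ {n} {i j k : Fin n} → k ≢ i → k ≢ j → PC.transpose i j k ≡ k
transpose-other {i = i} {j} {k} k≢i k≢j with k Fin.≟ i
... | yes k≡i = contradiction k≡i k≢i
... | no _ with k Fin.≟ j
...   | yes k≡j = contradiction k≡j k≢j
...   | no _ = refl

transpose-adjacent-< : ∀ {n} {i j : Fin n} → toℕ j ≡ suc (toℕ i) → ∀ {a b} → toℕ a < toℕ b →
  ¬ (a ≡ i × b ≡ j) → toℕ (PC.transpose j i a) < toℕ (PC.transpose j i b)
transpose-adjacent-< {i = i} {j} j≡1+i {a} {b} a<b not-ij = go (a Fin.≟ j) (a Fin.≟ i) (b Fin.≟ j) (b Fin.≟ i)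
  where
  i<j : toℕ i < toℕ j
  i<j = ≤-reflexive (sym j≡1+i)
  go : Dec (a ≡ j) → Dec (a ≡ i) → Dec (b ≡ j) → Dec (b ≡ i) → toℕ (PC.transpose j i a) < toℕ (PC.transpose j i b)
  go (yes refl) _ (yes refl) _ = contradiction a<b (<-irrefl refl)
  go (yes refl) _ (no _) (yes refl) = contradiction i<j (<-asym a<b)
  go (yes refl) _ (no b≢j) (no b≢i) rewrite transpose-left j i | transpose-other b≢j b≢i = <-trans i<j a<b
  go (no _) (yes refl) (yes refl) _ = contradiction (refl , refl) not-ij
  go (no _) (yes refl) (no _) (yes refl) = contradiction a<b (<-irrefl refl)
  go (no _) (yes refl) (no b≢j) (no b≢i) rewrite transpose-right j i | transpose-other b≢j b≢i =
    ≤∧≢⇒< (subst (_≤ toℕ b) (sym j≡1+i) a<b) (b≢j ∘ toℕ-injective ∘ sym)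
  go (no a≢j) (no a≢i) (yes refl) _ rewrite transpose-left j i | transpose-other a≢j a≢i =
    ≤∧≢⇒< (s≤s⁻¹ (subst (toℕ a <_) j≡1+i a<b)) (a≢i ∘ toℕ-injective)
  go (no a≢j) (no a≢i) (no _) (yes refl) rewrite transpose-right j i | transpose-other a≢j a≢i = <-trans a<b i<j
  go (no a≢j) (no a≢i) (no b≢j) (no b≢i) rewrite transpose-other a≢j a≢i | transpose-other b≢j b≢i = a<b

indicator : ∀ {P : Set} → Dec P → ℕ
indicator (yes _) = 1
indicator (no _) = 0

indicator-mono : ∀ {P Q : Set} (p : Dec P) (q : Dec Q) → (P → Q) → indicator p ≤ indicator q
indicator-mono (yes _) (yes _) _ = ≤-refl
indicator-mono (yes p) (no ¬q) p→q = contradiction (p→q p) ¬q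
indicator-mono (no _) _ _ = z≤n

indicator-< : ∀ {P Q : Set} (p : Dec P) (q : Dec Q) → ¬ P → Q → indicator p < indicator q
indicator-< (yes p) _ ¬p _ = contradiction p ¬p
indicator-< (no _) (yes _) _ _ = s≤s z≤n
indicator-< (no _) (no ¬q) _ q = contradiction q ¬q

sum-mono-≤ : ∀ {n} {f g : Fin n → ℕ} → (∀ k → f k ≤ g k) → sum f ≤ sum g
sum-mono-≤ {0} _ = z≤n
sum-mono-≤ {suc n} f≤g = +-mono-≤ (f≤g zero) (sum-mono-≤ (f≤g ∘ suc))

sum-mono-< : ∀ {n} {f g : Fin n → ℕ} → (∀ k → f k ≤ g k) → ∀ k → f k < g k → sum f < sum g
sum-mono-< f≤g zero fk<gk = +-mono-<-≤ fk<gk (sum-mono-≤ (f≤g ∘ suc))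
sum-mono-< f≤g (suc k) fk<gk = +-mono-≤-< (f≤g zero) (sum-mono-< (f≤g ∘ suc) k fk<gk)

length-filter-tabulate : ∀ {A : Set} {P : A → Set} (P? : Decidable P) {n} (f : Fin n → A) →
  length (filter P? (tabulate f)) ≡ sum (λ k → indicator (P? (f k)))
length-filter-tabulate P? {0} f = refl
length-filter-tabulate P? {suc n} f with P? (f zero)
... | yes _ = cong suc (length-filter-tabulate P? (λ k → f (suc k)))
... | no _ = length-filter-tabulate P? (λ k → f (suc k))

length-filter-cartesianProduct : ∀ {A B : Set} {P : A × B → Set} (P? : Decidable P) {m} (f : Fin m → A) (ys : List B) →
  length (filter P? (cartesianProduct (tabulate f) ys)) ≡ sum (λ k → length (filter P? (map (f k ,_) ys)))
length-filter-cartesianProduct P? {0} f ys = refl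
length-filter-cartesianProduct P? {suc m} f ys = begin
  length (filter P? (first ++ rest))                 ≡⟨ cong length (List.filter-++ P? first rest) ⟩
  length (filter P? first ++ filter P? rest)         ≡⟨ List.length-++ (filter P? first) ⟩
  length (filter P? first) + length (filter P? rest) ≡⟨ cong (length (filter P? first) +_)
                                                          (length-filter-cartesianProduct P? (λ k → f (suc k)) ys) ⟩
  sum (λ k → length (filter P? (map (f k ,_) ys)))   ∎
  where
  open ≡-Reasoning
  first = map (f zero ,_) ys
  rest = cartesianProduct (tabulate (λ k → f (suc k))) ys

inversion? : ∀ {n} (w : Permutation′ n) (ab : Fin n × Fin n) →
  Dec (toℕ (proj₁ ab) < toℕ (proj₂ ab) × val w (proj₂ ab) < val w (proj₁ ab))
inversion? w ab = (toℕ (proj₁ ab) <? toℕ (proj₂ ab)) ×-dec (val w (proj₂ ab) <? val w (proj₁ ab))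

inversions-sum : ∀ {n} (w : Permutation′ n) → inversions w ≡ sum (λ a → sum (λ b → indicator (inversion? w (a , b))))
inversions-sum {n} w = trans (length-filter-cartesianProduct (inversion? w) id (allFin n)) (sum-cong-≗ λ a →
  trans (cong (length ∘ filter (inversion? w)) (map-tabulate id (a ,_))) (length-filter-tabulate (inversion? w) (a ,_)))

-- w (i j), that is w sᵢ when j = i + 1; note that _∘ₚ_ composes in diagrammatic order
swapAdjacent : ∀ {n} → Permutation′ n → Fin n → Fin n → Permutation′ n
swapAdjacent w i j = transpose j i ∘ₚ w

module _ {n} (w : Permutation′ n) (i j : Fin n) where

  val-swapAdjacent-i : val (swapAdjacent w i j) i ≡ val w j
  val-swapAdjacent-i = cong (suc ∘ toℕ ∘ (w ⟨$⟩ʳ_)) (transpose-right j i)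

  val-swapAdjacent-j : val (swapAdjacent w i j) j ≡ val w i
  val-swapAdjacent-j = cong (suc ∘ toℕ ∘ (w ⟨$⟩ʳ_)) (transpose-left j i)

  val-swapAdjacent-other : ∀ {k} → k ≢ i → k ≢ j → val (swapAdjacent w i j) k ≡ val w k
  val-swapAdjacent-other k≢i k≢j = cong (suc ∘ toℕ ∘ (w ⟨$⟩ʳ_)) (transpose-other k≢j k≢i)

module _ {n} (w : Permutation′ n) {i j : Fin n} (j≡1+i : toℕ j ≡ suc (toℕ i)) (descent : val w j < val w i) where

  private
    u = swapAdjacent w i j
    t = PC.transpose j i

    i<j : toℕ i < toℕ j
    i<j = ≤-reflexive (sym j≡1+i)

    not-ij : ∀ {a b} → val u b < val u a → ¬ (a ≡ i × b ≡ j)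
    not-ij u[b]<u[a] (refl , refl) rewrite transpose-left j i | transpose-right j i = <-asym u[b]<u[a] descent

    order : ∀ {a b} → toℕ a < toℕ b → val u b < val u a → toℕ (t a) < toℕ (t b)
    order a<b u[b]<u[a] = transpose-adjacent-< j≡1+i a<b (not-ij u[b]<u[a])

  inversions-swapAdjacent : inversions (swapAdjacent w i j) < inversions w
  inversions-swapAdjacent = begin-strict
    inversions u                                             ≡⟨ inversions-sum u ⟩
    sum (λ a → sum (λ b → indicator (inversion? u (a , b))))  <⟨ sum-mono-< (λ a → sum-mono-≤ (pointwise a)) j
                                                                   (sum-mono-< (pointwise j) i at-ji) ⟩
    sum (λ a → sum (λ b → F (t a) (t b)))                     ≡⟨ sum-cong-≗ (λ a → sum-permute (F (t a)) (transpose j i)) ⟨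
    sum (λ a → sum (F (t a)))                                ≡⟨ sum-permute (λ a → sum (F a)) (transpose j i) ⟨
    sum (λ a → sum (F a))                                    ≡⟨ inversions-sum w ⟨
    inversions w                                             ∎
    where
    open ≤-Reasoning
    F : Fin n → Fin n → ℕ
    F a b = indicator (inversion? w (a , b))
    pointwise : ∀ a b → indicator (inversion? u (a , b)) ≤ F (t a) (t b)
    pointwise a b = indicator-mono (inversion? u (a , b)) (inversion? w (t a , t b))
                      λ (a<b , u[b]<u[a]) → order a<b u[b]<u[a] , u[b]<u[a]
    at-ji : indicator (inversion? u (j , i)) < F (t j) (t i)
    at-ji = indicator-< (inversion? u (j , i)) (inversion? w (t j , t i)) (<-asym i<j ∘ proj₁)
               (subst₂ (λ a b → toℕ a < toℕ b × val w b < val w a) (sym (transpose-left j i)) (sym (transpose-right j i))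
                 (i<j , descent))

  swapAdjacent-fullyCommutative : FullyCommutative w → FullyCommutative (swapAdjacent w i j)
  swapAdjacent-fullyCommutative fc (a , b , c , a<b , b<c , u[b]<u[a] , u[c]<u[b]) =
    fc (t a , t b , t c , order a<b u[b]<u[a] , order b<c u[c]<u[b] , u[b]<u[a] , u[c]<u[b])

  swapAdjacent-<R : swapAdjacent w i j <R w
  swapAdjacent-<R =
    TransClosure.[ i , j , j≡1+i , (λ k → cong (w ⟨$⟩ʳ_) (sym (PC.transpose-inverse j i))) , inversions-swapAdjacent ]

  minimal⇒P-swapAdjacent-≢ : MinimalInC w → P (swapAdjacent w i j) ≢ P w
  minimal⇒P-swapAdjacent-≢ ((fc , crowded) , minimal) P≡ =
    minimal u (swapAdjacent-fullyCommutative fc , subst (λ T → Crowded (map ℤ.+_ (Row₂ T))) (sym P≡) crowded)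
      swapAdjacent-<R

P-swapAdjacent-yzx : ∀ {n} (w : Permutation′ n) {c i j} → toℕ i ≡ suc (toℕ c) → toℕ j ≡ suc (toℕ i) →
  val w j < val w c → val w c < val w i → P w ≡ P (swapAdjacent w i j)
P-swapAdjacent-yzx w {c} {i} {j} i≡1+c j≡1+i x<y y<z =
  P-knuth w (swapAdjacent w i j) c i j i≡1+c j≡1+i
    (λ k _ k≢i k≢j → sym (val-swapAdjacent-other w i j k≢i k≢j))
    (subst (ElementaryKnuth _) (sym values) (yzx∼yxz x<y y<z))
  where
  c<i = ≤-reflexive (sym i≡1+c)
  values : val (swapAdjacent w i j) c ∷ val (swapAdjacent w i j) i ∷ val (swapAdjacent w i j) j ∷ [] ≡
           val w c ∷ val w j ∷ val w i ∷ []
  values = cong₂ _∷_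
             (val-swapAdjacent-other w i j (≢-of-toℕ-< c<i) (≢-of-toℕ-< (<-trans c<i (≤-reflexive (sym j≡1+i)))))
             (cong₂ _∷_ (val-swapAdjacent-i w i j) (cong (_∷ []) (val-swapAdjacent-j w i j)))

P-swapAdjacent-xzy : ∀ {n} (w : Permutation′ n) {i j k} → toℕ j ≡ suc (toℕ i) → toℕ k ≡ suc (toℕ j) →
  val w j < val w k → val w k < val w i → P (swapAdjacent w i j) ≡ P w
P-swapAdjacent-xzy w {i} {j} {k} j≡1+i k≡1+j x<y y<z =
  P-knuth (swapAdjacent w i j) w i j k j≡1+i k≡1+j
    (λ _ m≢i m≢j _ → val-swapAdjacent-other w i j m≢i m≢j)
    (subst (λ W → ElementaryKnuth W (val w i ∷ val w j ∷ val w k ∷ [])) (sym values) (xzy∼zxy x<y y<z))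
  where
  j<k = ≤-reflexive (sym k≡1+j)
  values : val (swapAdjacent w i j) i ∷ val (swapAdjacent w i j) j ∷ val (swapAdjacent w i j) k ∷ [] ≡
           val w j ∷ val w i ∷ val w k ∷ []
  values = cong₂ _∷_ (val-swapAdjacent-i w i j)
             (cong₂ _∷_ (val-swapAdjacent-j w i j)
               (cong (_∷ []) (val-swapAdjacent-other w i j
                  (≢-of-toℕ-< (<-trans (≤-reflexive (sym j≡1+i)) j<k) ∘ sym) (≢-of-toℕ-< j<k ∘ sym))))

-- Fixed points of minimal elements of 𝒞ₙ

module _ {n} (w : Permutation′ n) where

  val-≮⇒> : ∀ {a b} → a ≢ b → ¬ val w a < val w b → val w b < val w a
  val-≮⇒> a≢b w[a]≮w[b] = ≤∧≢⇒< (≮⇒≥ w[a]≮w[b]) (a≢b ∘ sym ∘ val-injective w)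

  val-mono-≤ : ∀ {a b} → (toℕ a < toℕ b → val w a < val w b) → toℕ a ≤ toℕ b → val w a ≤ val w b
  val-mono-≤ strict a≤b with m≤n⇒m<n∨m≡n a≤b
  ... | inj₁ a<b = <⇒≤ (strict a<b)
  ... | inj₂ a≡b = ≤-reflexive (cong (val w) (toℕ-injective a≡b))

  ascent-unless-descent : ∀ {a b} → toℕ b ≡ suc (toℕ a) → ¬ Descent w (suc (toℕ a)) → val w a < val w b
  ascent-unless-descent b≡1+a not-descent =
    val-≮⇒> (≢-of-toℕ-< (≤-reflexive (sym b≡1+a)) ∘ sym) λ w[b]<w[a] →
      not-descent (_ , _ , refl , b≡1+a , w[b]<w[a])

  fullyCommutative-after : FullyCommutative w → ∀ {i j b} → toℕ i < toℕ j → val w j < val w i →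
    toℕ j < toℕ b → val w j < val w b
  fullyCommutative-after fc {i} {j} {b} i<j w[j]<w[i] j<b =
    val-≮⇒> (≢-of-toℕ-< j<b ∘ sym) λ w[b]<w[j] → fc (i , j , b , i<j , j<b , w[j]<w[i] , w[b]<w[j])

  fullyCommutative-before : FullyCommutative w → ∀ {i j a} → toℕ i < toℕ j → val w j < val w i →
    toℕ a < toℕ i → val w a < val w i
  fullyCommutative-before fc {i} {j} {a} i<j w[j]<w[i] a<i =
    val-≮⇒> (≢-of-toℕ-< a<i ∘ sym) λ w[i]<w[a] → fc (a , i , j , a<i , i<j , w[i]<w[a] , w[j]<w[i])

  -- otherwise the move yzx → yxz at positions c i j lowers w without changing P
  minimal-descent-after-ascent : MinimalInC w → ∀ {c i j} → toℕ i ≡ suc (toℕ c) → toℕ j ≡ suc (toℕ i) →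
    val w j < val w i → val w c < val w i → val w c < val w j
  minimal-descent-after-ascent minimal {c} {i} {j} i≡1+c j≡1+i w[j]<w[i] w[c]<w[i] =
    val-≮⇒> (≢-of-toℕ-< (<-trans (≤-reflexive (sym i≡1+c)) (≤-reflexive (sym j≡1+i))) ∘ sym) λ w[j]<w[c] →
      minimal⇒P-swapAdjacent-≢ w j≡1+i w[j]<w[i] minimal (sym (P-swapAdjacent-yzx w i≡1+c j≡1+i w[j]<w[c] w[c]<w[i]))

  -- otherwise the move xzy → zxy at positions i j k lowers w without changing P
  minimal-descent-before-ascent : MinimalInC w → ∀ {i j k} → toℕ j ≡ suc (toℕ i) → toℕ k ≡ suc (toℕ j) →
    val w j < val w i → val w j < val w k → val w i < val w k
  minimal-descent-before-ascent minimal {i} {j} {k} j≡1+i k≡1+j w[j]<w[i] w[j]<w[k] =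
    val-≮⇒> (≢-of-toℕ-< (<-trans (≤-reflexive (sym j≡1+i)) (≤-reflexive (sym k≡1+j))) ∘ sym) λ w[k]<w[i] →
      minimal⇒P-swapAdjacent-≢ w j≡1+i w[j]<w[i] minimal (P-swapAdjacent-xzy w j≡1+i k≡1+j w[j]<w[k] w[k]<w[i])

  -- the value j cannot sit left of j (those positions are fixed), nor right of j (then w(j) < j
  -- would be a smaller fixed point)
  fixes-below : ∀ B → (∀ {a b} → toℕ a < toℕ b → toℕ a < B → val w a < val w b) →
    ∀ j → toℕ j < B → w ⟨$⟩ʳ j ≡ j
  fixes-below B below = WF.All.wfRec <-wellFounded _ (λ j → toℕ j < B → w ⟨$⟩ʳ j ≡ j) step
    where
    step : ∀ j → (∀ {k} → toℕ k < toℕ j → toℕ k < B → w ⟨$⟩ʳ k ≡ k) → toℕ j < B → w ⟨$⟩ʳ j ≡ j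
    step j ih j<B with <-cmp (toℕ (w ⟨$⟩ˡ j)) (toℕ j)
    ... | tri< m<j _ _ = contradiction (cong toℕ (trans (sym (ih m<j (<-trans m<j j<B))) (inverseʳ w))) (<⇒≢ m<j)
    ... | tri≈ _ m≡j _ = trans (cong (w ⟨$⟩ʳ_) (sym (toℕ-injective m≡j))) (inverseʳ w)
    ... | tri> _ _ j<m = contradiction (⟨$⟩ʳ-injective w (ih w[j]<j (<-trans w[j]<j j<B))) (<⇒≢ w[j]<j ∘ cong toℕ)
      where
      w[j]<j : toℕ (w ⟨$⟩ʳ j) < toℕ j
      w[j]<j = s≤s⁻¹ (subst (val w j <_) (cong (suc ∘ toℕ) (inverseʳ w)) (below j<m j<B))

  fixes-above : ∀ B → (∀ {a b} → toℕ a < toℕ b → B < toℕ b → val w a < val w b) →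
    ∀ j → B < toℕ j → w ⟨$⟩ʳ j ≡ j
  fixes-above B above = WF.All.wfRec >-wellFounded _ (λ j → B < toℕ j → w ⟨$⟩ʳ j ≡ j) step
    where
    step : ∀ j → (∀ {k} → toℕ j < toℕ k → B < toℕ k → w ⟨$⟩ʳ k ≡ k) → B < toℕ j → w ⟨$⟩ʳ j ≡ j
    step j ih B<j with <-cmp (toℕ (w ⟨$⟩ˡ j)) (toℕ j)
    ... | tri> _ _ j<m = contradiction (cong toℕ (trans (sym (ih j<m (<-trans B<j j<m))) (inverseʳ w))) (<⇒≢ j<m ∘ sym)
    ... | tri≈ _ m≡j _ = trans (cong (w ⟨$⟩ʳ_) (sym (toℕ-injective m≡j))) (inverseʳ w)
    ... | tri< m<j _ _ = contradiction (⟨$⟩ʳ-injective w (ih j<w[j] (<-trans B<j j<w[j]))) (<⇒≢ j<w[j] ∘ cong toℕ ∘ sym)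
      where
      j<w[j] : toℕ j < toℕ (w ⟨$⟩ʳ j)
      j<w[j] = s≤s⁻¹ (subst (_< val w j) (cong (suc ∘ toℕ) (inverseʳ w)) (above m<j B<j))

ascents⇒increasing : ∀ {n} (f : Fin n → ℕ) {lo hi : ℕ} →
  (∀ {a b} → toℕ b ≡ suc (toℕ a) → lo ≤ toℕ a → toℕ b ≤ hi → f a < f b) →
  ∀ {a b} → lo ≤ toℕ a → toℕ a < toℕ b → toℕ b ≤ hi → f a < f b
ascents⇒increasing f {lo} {hi} ascent {a} {b} lo≤a a<b b≤hi = WF.All.wfRec <-wellFounded _ Below step b a lo≤a a<b b≤hi
  where
  Below : Fin _ → Set
  Below b = ∀ a → lo ≤ toℕ a → toℕ a < toℕ b → toℕ b ≤ hi → f a < f b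
  step : ∀ b → (∀ {b′} → toℕ b′ < toℕ b → Below b′) → Below b
  step (suc y) ih a lo≤a a<b b≤hi with m≤n⇒m<n∨m≡n (s≤s⁻¹ a<b)
  ... | inj₂ a≡y = ascent (cong suc (sym a≡y)) lo≤a b≤hi
  ... | inj₁ a<y = <-trans (ih y′<b a lo≤a a<y′ (<⇒≤ (≤-<-trans (≤-reflexive y′≡y) b≤hi)))
                           (ascent (cong suc (sym y′≡y)) (≤-trans lo≤a (<⇒≤ a<y′)) b≤hi)
    where
    y′≡y = toℕ-inject₁ y
    a<y′ = subst (toℕ a <_) (sym y′≡y) a<y
    y′<b : toℕ (inject₁ y) < suc (toℕ y)
    y′<b = s≤s (≤-reflexive y′≡y)

predecessor : ∀ {n} (i : Fin n) → 0 < toℕ i → Σ (Fin n) λ c → toℕ i ≡ suc (toℕ c)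
predecessor (suc y) _ = inject₁ y , cong suc (sym (toℕ-inject₁ y))

successor : ∀ {n} (j p : Fin n) → toℕ j < toℕ p → Σ (Fin n) λ k → toℕ k ≡ suc (toℕ j)
successor j p j<p = fromℕ< (≤-<-trans j<p (toℕ<n p)) , toℕ-fromℕ< _

fixed-before-firstDescent : ∀ {n} (w : Permutation′ n) {d} → MinimalInC w → FirstDescent w d →
  ∀ p → suc (toℕ p) < d → w ⟨$⟩ʳ p ≡ p
fixed-before-firstDescent w minimal@((fc , _) , _) ((i , j , refl , j≡1+i , w[j]<w[i]) , first) p p<i′ =
  fixes-below w (toℕ i) below p p<i
  where
  p<i = s≤s⁻¹ p<i′
  i<j = ≤-reflexive (sym j≡1+i)
  increasing : ∀ {a b} → toℕ a < toℕ b → toℕ b ≤ toℕ i → val w a < val w b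
  increasing = ascents⇒increasing (val w) {0} {toℕ i}
    (λ b≡1+a _ b≤i → ascent-unless-descent w b≡1+a λ descent →
       <-irrefl refl (≤-trans (first _ descent) (subst (_≤ toℕ i) b≡1+a b≤i)))
    z≤n
  c = proj₁ (predecessor i (≤-<-trans z≤n p<i))
  i≡1+c = proj₂ (predecessor i (≤-<-trans z≤n p<i))
  w[c]<w[j] : val w c < val w j
  w[c]<w[j] = minimal-descent-after-ascent w minimal i≡1+c j≡1+i w[j]<w[i] (increasing (≤-reflexive (sym i≡1+c)) ≤-refl)
  below : ∀ {a b} → toℕ a < toℕ b → toℕ a < toℕ i → val w a < val w b
  below {a} {b} a<b a<i with toℕ b ≤? toℕ i
  ... | yes b≤i = increasing a<b b≤i
  ... | no b≰i = ≤-<-trans w[a]≤w[c] (<-≤-trans w[c]<w[j] w[j]≤w[b])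
    where
    w[a]≤w[c] = val-mono-≤ w (λ a<c → increasing a<c (<⇒≤ (≤-reflexive (sym i≡1+c))))
                  (s≤s⁻¹ (subst (toℕ a <_) i≡1+c a<i))
    w[j]≤w[b] = val-mono-≤ w (fullyCommutative-after w fc i<j w[j]<w[i]) (subst (_≤ toℕ b) (sym j≡1+i) (≰⇒> b≰i))

fixed-after-lastDescent : ∀ {n} (w : Permutation′ n) {d′} → MinimalInC w → LastDescent w d′ →
  ∀ p → d′ + 2 ≤ suc (toℕ p) → w ⟨$⟩ʳ p ≡ p
fixed-after-lastDescent {n} w minimal@((fc , _) , _) ((i , j , refl , j≡1+i , w[j]<w[i]) , last) p p≥ =
  fixes-above w (toℕ j) above p j<p
  where
  i<j = ≤-reflexive (sym j≡1+i)
  j<p : toℕ j < toℕ p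
  j<p = subst (λ m → suc m ≤ toℕ p) (sym j≡1+i) (subst (_≤ toℕ p) (+-comm (toℕ i) 2) (s≤s⁻¹ p≥))
  increasing : ∀ {a b} → toℕ j ≤ toℕ a → toℕ a < toℕ b → val w a < val w b
  increasing j≤a a<b = ascents⇒increasing (val w) {toℕ j} {n}
    (λ b≡1+a j≤a _ → ascent-unless-descent w b≡1+a λ descent →
       <-irrefl refl (≤-trans (subst (_≤ _) j≡1+i j≤a) (s≤s⁻¹ (last _ descent))))
    j≤a a<b (<⇒≤ (toℕ<n _))
  k = proj₁ (successor j p j<p)
  k≡1+j = proj₂ (successor j p j<p)
  w[i]<w[k] : val w i < val w k
  w[i]<w[k] = minimal-descent-before-ascent w minimal j≡1+i k≡1+j w[j]<w[i] (increasing ≤-refl (≤-reflexive (sym k≡1+j)))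
  above : ∀ {a b} → toℕ a < toℕ b → toℕ j < toℕ b → val w a < val w b
  above {a} {b} a<b j<b with toℕ j ≤? toℕ a
  ... | yes j≤a = increasing j≤a a<b
  ... | no j≰a = ≤-<-trans w[a]≤w[i] (<-≤-trans w[i]<w[k] w[k]≤w[b])
    where
    w[a]≤w[i] = val-mono-≤ w (fullyCommutative-before w fc i<j w[j]<w[i])
                  (s≤s⁻¹ (subst (toℕ a <_) j≡1+i (≰⇒> j≰a)))
    w[k]≤w[b] = val-mono-≤ w (increasing (<⇒≤ (≤-reflexive (sym k≡1+j)))) (subst (_≤ toℕ b) (sym k≡1+j) j<b)

corollary5p6 : (n : ℕ) (w : Permutation′ n) (d d′ : ℕ) →
    MinimalInC w → FirstDescent w d → LastDescent w d′ →
    (p : Fin n) → (suc (toℕ p) < d ⊎ d′ + 2 ≤ suc (toℕ p)) → w ⟨$⟩ʳ p ≡ p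
corollary5p6 n w d d′ minimal first last p (inj₁ p<d) = fixed-before-firstDescent w minimal first p p<d
corollary5p6 n w d d′ minimal first last p (inj₂ p>d′) = fixed-after-lastDescent w minimal last p p>d′
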